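{- The sentence $$\forall x,y\ \big(x \prec y \Rightarrow \exists z\ (z \prec z \ \&\ x \prec z \ \&\ z \prec y)\big)$$ is provable in $\mathsf{Con}^\star$, the model completion of the theory of contact algebras; equivalently, it holds in every existentially closed contact algebra.
   Context: A contact algebra is a pair $(B,\prec)$ with $B$ a Boolean algebra and $\prec$ a binary relation satisfying: $0\prec0$, $1\prec1$; $a\prec b,c\Rightarrow a\prec b\wedge c$; $a,b\prec c\Rightarrow a\vee b\prec c$; $a\le b\prec c\le d\Rightarrow a\prec d$; $a\prec b\Rightarrow a\le b$; $a\prec b\Rightarrow \neg b\prec\neg a$. The first-order theory of contact algebras has a model completion $\mathsf{Con}^\star$, whose models are exactly the existentially closed contact algebras (those in which every existential sentence with parameters that holds in some contact algebra extension already holds). -}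

module Defs where

open import Level using (Level; _⊔_; suc)
open import Data.Nat using (ℕ)
open import Data.Fin using (Fin)
open import Data.Product using (_×_; Σ)
open import Data.Sum using (_⊎_)
open import Relation.Nullary renaming (¬_ to Not)
open import Algebra.Lattice.Bundles using (BooleanAlgebra)

record ContactAlgebra (c ℓ : Level) : Set (suc (c ⊔ ℓ)) where
  field
    boolAlg : BooleanAlgebra c ℓ
  open BooleanAlgebra boolAlg public
  _≤_ : Carrier → Carrier → Set ℓ
  a ≤ b = (a ∧ b) ≈ a
  infix 4 _≺_
  field
    _≺_    : Carrier → Carrier → Set ℓ
    ≺-⊥    : ⊥ ≺ ⊥
    ≺-⊤    : ⊤ ≺ ⊤
    ≺-∧    : ∀ {a b c} → a ≺ b → a ≺ c → a ≺ (b ∧ c)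
    ≺-∨    : ∀ {a b c} → a ≺ c → b ≺ c → (a ∨ b) ≺ c
    ≺-mono : ∀ {a b c d} → a ≤ b → b ≺ c → c ≤ d → a ≺ d
    ≺⇒≤    : ∀ {a b} → a ≺ b → a ≤ b
    ≺-¬    : ∀ {a b} → a ≺ b → (¬ b) ≺ (¬ a)

open ContactAlgebra

record Embedding {c ℓ} (A B : ContactAlgebra c ℓ) : Set (c ⊔ ℓ) where
  private
    module A = ContactAlgebra A
    module B = ContactAlgebra B
  field
    f      : A.Carrier → B.Carrier
    f-cong : ∀ {x y} → x A.≈ y → f x B.≈ f y
    f-inj  : ∀ {x y} → f x B.≈ f y → x A.≈ y
    f-∧    : ∀ x y → f (x A.∧ y) B.≈ (f x B.∧ f y)
    f-∨    : ∀ x y → f (x A.∨ y) B.≈ (f x B.∨ f y)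
    f-¬    : ∀ x → f (A.¬ x) B.≈ (B.¬ f x)
    f-⊤    : f A.⊤ B.≈ B.⊤
    f-⊥    : f A.⊥ B.≈ B.⊥
    f-≺    : ∀ {x y} → x A.≺ y → f x B.≺ f y
    f-≺⁻   : ∀ {x y} → f x B.≺ f y → x A.≺ y

data Term {p} (P : Set p) (n : ℕ) : Set p where
  var   : Fin n → Term P n
  par   : P → Term P n
  _∧ₜ_  : Term P n → Term P n → Term P n
  _∨ₜ_  : Term P n → Term P n → Term P n
  ¬ₜ_   : Term P n → Term P n
  ⊤ₜ ⊥ₜ : Term P n

data QF {p} (P : Set p) (n : ℕ) : Set p where
  _≐_    : Term P n → Term P n → QF P n
  _≺ₜ_   : Term P n → Term P n → QF P n
  notF   : QF P n → QF P n
  andF   : QF P n → QF P n → QF P n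
  orF    : QF P n → QF P n → QF P n

module _ {c ℓ} (B : ContactAlgebra c ℓ) {p} {P : Set p} (π : P → Carrier B) {n : ℕ} where
  private module B = ContactAlgebra B

  evalT : (Fin n → B.Carrier) → Term P n → B.Carrier
  evalT ρ (var i)   = ρ i
  evalT ρ (par p)   = π p
  evalT ρ (s ∧ₜ t)  = evalT ρ s B.∧ evalT ρ t
  evalT ρ (s ∨ₜ t)  = evalT ρ s B.∨ evalT ρ t
  evalT ρ (¬ₜ t)    = B.¬ evalT ρ t
  evalT ρ ⊤ₜ        = B.⊤
  evalT ρ ⊥ₜ        = B.⊥

  Sat : (Fin n → B.Carrier) → QF P n → Set ℓ
  Sat ρ (s ≐ t)    = evalT ρ s B.≈ evalT ρ t
  Sat ρ (s ≺ₜ t)   = evalT ρ s B.≺ evalT ρ t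
  Sat ρ (notF φ)   = Not (Sat ρ φ)
  Sat ρ (andF φ ψ) = Sat ρ φ × Sat ρ ψ
  Sat ρ (orF φ ψ)  = Sat ρ φ ⊎ Sat ρ ψ

  SatEx : QF P n → Set (c ⊔ ℓ)
  SatEx φ = Σ (Fin n → B.Carrier) (λ ρ → Sat ρ φ)

IsExistentiallyClosed : ∀ {c ℓ} → ContactAlgebra c ℓ → Set (suc (c ⊔ ℓ))
IsExistentiallyClosed {c} {ℓ} A =
  (B : ContactAlgebra c ℓ) (e : Embedding A B)
  {n : ℕ} (φ : QF (Carrier A) n) →
  SatEx B (Embedding.f e) φ → SatEx A (λ a → a) φ

{-# OPTIONS --safe #-}
module Submission where

-- Given x ≺ y, embed A diagonally into the product of the relativisations A ∣ y and
-- A ∣ ¬ x, where A ∣ u identifies elements that agree below u and relates a ≺ b iff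
-- a ∧ u ≺ b ∨ ¬ u.  The diagonal is injective since y ∨ ¬ x = ⊤, and it reflects ≺
-- because x ≺ y lets one cut a into the pieces below x, between x and y, and outside y.
-- In the product, (y , ⊥) is self-contact and satisfies x ≺ (y , ⊥) ≺ y, so
-- existential closedness yields such an element already in A.

open import Defs
open import Data.Product using (Σ; _×_; _,_; proj₁; proj₂)
open import Data.Fin using (zero)
open import Function using (const)
open import Relation.Binary.Core using (Rel; _⇒_)
open import Relation.Binary.Structures using (IsEquivalence)
open import Algebra.Core using (Op₁; Op₂)
open import Algebra.Lattice.Bundles using (BooleanAlgebra)
open import Algebra.Lattice.Structures using (IsBooleanAlgebra)
import Algebra.Definitions as Definitions
import Algebra.Lattice.Properties.BooleanAlgebra as BooleanAlgebraProperties
import Relation.Binary.Reasoning.Setoid as SetoidReasoning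

module _ {c ℓ ℓ′} {A : Set c} {_≈_ : Rel A ℓ} {_∨_ _∧_ : Op₂ A} {¬_ : Op₁ A} {⊤ ⊥ : A}
         (isBA : IsBooleanAlgebra _≈_ _∨_ _∧_ ¬_ ⊤ ⊥) {_≈′_ : Rel A ℓ′} where
  open IsBooleanAlgebra isBA
  open Definitions _≈′_ using (Congruent₁; Congruent₂)

  isBooleanAlgebra-coarsen : IsEquivalence _≈′_ → _≈_ ⇒ _≈′_ →
    Congruent₂ _∨_ → Congruent₂ _∧_ → Congruent₁ ¬_ →
    IsBooleanAlgebra _≈′_ _∨_ _∧_ ¬_ ⊤ ⊥
  isBooleanAlgebra-coarsen isEq incl ∨-cong′ ∧-cong′ ¬-cong′ = record
    { isDistributiveLattice = record
      { isLattice = record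
        { isEquivalence = isEq
        ; ∨-comm        = λ a b → incl (∨-comm a b)
        ; ∨-assoc       = λ a b d → incl (∨-assoc a b d)
        ; ∨-cong        = ∨-cong′
        ; ∧-comm        = λ a b → incl (∧-comm a b)
        ; ∧-assoc       = λ a b d → incl (∧-assoc a b d)
        ; ∧-cong        = ∧-cong′
        ; absorptive    = (λ a b → incl (∨-absorbs-∧ a b)) , (λ a b → incl (∧-absorbs-∨ a b))
        }
      ; ∨-distrib-∧ = (λ a b d → incl (∨-distribˡ-∧ a b d)) , (λ a b d → incl (∨-distribʳ-∧ a b d))
      ; ∧-distrib-∨ = (λ a b d → incl (∧-distribˡ-∨ a b d)) , (λ a b d → incl (∧-distribʳ-∨ a b d))
      }
    ; ∨-complement = (λ a → incl (∨-complementˡ a)) , (λ a → incl (∨-complementʳ a))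
    ; ∧-complement = (λ a → incl (∧-complementˡ a)) , (λ a → incl (∧-complementʳ a))
    ; ¬-cong       = ¬-cong′
    }

module _ {a b ℓ₁ ℓ₂} (A : BooleanAlgebra a ℓ₁) (B : BooleanAlgebra b ℓ₂) where
  private
    module A = BooleanAlgebra A
    module B = BooleanAlgebra B

  infixr 2 _×-booleanAlgebra_
  _×-booleanAlgebra_ : BooleanAlgebra _ _
  _×-booleanAlgebra_ = record
    { Carrier = A.Carrier × B.Carrier
    ; _≈_ = λ p q → proj₁ p A.≈ proj₁ q × proj₂ p B.≈ proj₂ q
    ; _∨_ = λ p q → proj₁ p A.∨ proj₁ q , proj₂ p B.∨ proj₂ q
    ; _∧_ = λ p q → proj₁ p A.∧ proj₁ q , proj₂ p B.∧ proj₂ q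
    ; ¬_  = λ p → A.¬ proj₁ p , B.¬ proj₂ p
    ; ⊤ = A.⊤ , B.⊤
    ; ⊥ = A.⊥ , B.⊥
    ; isBooleanAlgebra = record
      { isDistributiveLattice = record
        { isLattice = record
          { isEquivalence = record
            { refl  = A.refl , B.refl
            ; sym   = λ (p , q) → A.sym p , B.sym q
            ; trans = λ (p , q) (p′ , q′) → A.trans p p′ , B.trans q q′
            }
          ; ∨-comm  = λ p q → A.∨-comm _ _ , B.∨-comm _ _
          ; ∨-assoc = λ p q r → A.∨-assoc _ _ _ , B.∨-assoc _ _ _
          ; ∨-cong  = λ (p , q) (p′ , q′) → A.∨-cong p p′ , B.∨-cong q q′
          ; ∧-comm  = λ p q → A.∧-comm _ _ , B.∧-comm _ _
          ; ∧-assoc = λ p q r → A.∧-assoc _ _ _ , B.∧-assoc _ _ _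
          ; ∧-cong  = λ (p , q) (p′ , q′) → A.∧-cong p p′ , B.∧-cong q q′
          ; absorptive = (λ p q → A.∨-absorbs-∧ _ _ , B.∨-absorbs-∧ _ _)
                       , (λ p q → A.∧-absorbs-∨ _ _ , B.∧-absorbs-∨ _ _)
          }
        ; ∨-distrib-∧ = (λ p q r → A.∨-distribˡ-∧ _ _ _ , B.∨-distribˡ-∧ _ _ _)
                      , (λ p q r → A.∨-distribʳ-∧ _ _ _ , B.∨-distribʳ-∧ _ _ _)
        ; ∧-distrib-∨ = (λ p q r → A.∧-distribˡ-∨ _ _ _ , B.∧-distribˡ-∨ _ _ _)
                      , (λ p q r → A.∧-distribʳ-∨ _ _ _ , B.∧-distribʳ-∨ _ _ _)
        }
      ; ∨-complement = (λ p → A.∨-complementˡ _ , B.∨-complementˡ _)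
                     , (λ p → A.∨-complementʳ _ , B.∨-complementʳ _)
      ; ∧-complement = (λ p → A.∧-complementˡ _ , B.∧-complementˡ _)
                     , (λ p → A.∧-complementʳ _ , B.∧-complementʳ _)
      ; ¬-cong = λ (p , q) → A.¬-cong p , B.¬-cong q
      }
    }

module ContactAlgebraProperties {c ℓ} (A : ContactAlgebra c ℓ) where
  open ContactAlgebra A
  open BooleanAlgebraProperties boolAlg
  open SetoidReasoning setoid

  ≤-reflexive : ∀ {a b} → a ≈ b → a ≤ b
  ≤-reflexive {a} a≈b = trans (∧-congˡ (sym a≈b)) (∧-idem a)

  ≤-refl : ∀ {a} → a ≤ a
  ≤-refl = ≤-reflexive refl

  ≤-trans : ∀ {a b d} → a ≤ b → b ≤ d → a ≤ d
  ≤-trans {a} {b} {d} a≤b b≤d = begin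
    a ∧ d       ≈⟨ ∧-congʳ (sym a≤b) ⟩
    (a ∧ b) ∧ d ≈⟨ ∧-assoc a b d ⟩
    a ∧ (b ∧ d) ≈⟨ ∧-congˡ b≤d ⟩
    a ∧ b       ≈⟨ a≤b ⟩
    a           ∎

  x∧y≤x : ∀ a b → (a ∧ b) ≤ a
  x∧y≤x a b = begin
    (a ∧ b) ∧ a ≈⟨ ∧-congʳ (∧-comm a b) ⟩
    (b ∧ a) ∧ a ≈⟨ ∧-assoc b a a ⟩
    b ∧ (a ∧ a) ≈⟨ ∧-congˡ (∧-idem a) ⟩
    b ∧ a       ≈⟨ ∧-comm b a ⟩
    a ∧ b       ∎

  x∧y≤y : ∀ a b → (a ∧ b) ≤ b
  x∧y≤y a b = trans (∧-assoc a b b) (∧-congˡ (∧-idem b))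

  x≤x∨y : ∀ a b → a ≤ (a ∨ b)
  x≤x∨y = ∧-absorbs-∨

  ∧-greatest : ∀ {a b d} → a ≤ b → a ≤ d → a ≤ (b ∧ d)
  ∧-greatest {a} {b} {d} a≤b a≤d = trans (sym (∧-assoc a b d)) (trans (∧-congʳ a≤b) a≤d)

  ∧-distribʳ-∧ : ∀ a b u → (a ∧ b) ∧ u ≈ (a ∧ u) ∧ (b ∧ u)
  ∧-distribʳ-∧ a b u = begin
    (a ∧ b) ∧ u       ≈⟨ ∧-congˡ (sym (∧-idem u)) ⟩
    (a ∧ b) ∧ (u ∧ u) ≈⟨ ∧-assoc a b (u ∧ u) ⟩
    a ∧ (b ∧ (u ∧ u)) ≈⟨ ∧-congˡ (sym (∧-assoc b u u)) ⟩
    a ∧ ((b ∧ u) ∧ u) ≈⟨ ∧-congˡ (∧-comm (b ∧ u) u) ⟩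
    a ∧ (u ∧ (b ∧ u)) ≈⟨ sym (∧-assoc a u (b ∧ u)) ⟩
    (a ∧ u) ∧ (b ∧ u) ∎

  ∨-¬-∧ : ∀ a u → (a ∨ ¬ u) ∧ u ≈ a ∧ u
  ∨-¬-∧ a u = begin
    (a ∨ ¬ u) ∧ u       ≈⟨ ∧-distribʳ-∨ u a (¬ u) ⟩
    (a ∧ u) ∨ (¬ u ∧ u) ≈⟨ ∨-congˡ (∧-complementˡ u) ⟩
    (a ∧ u) ∨ ⊥         ≈⟨ ∨-identityʳ _ ⟩
    a ∧ u               ∎

  ∧-¬-∨ : ∀ a u → (a ∧ u) ∨ ¬ u ≈ a ∨ ¬ u
  ∧-¬-∨ a u = begin
    (a ∧ u) ∨ ¬ u         ≈⟨ ∨-distribʳ-∧ (¬ u) a u ⟩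
    (a ∨ ¬ u) ∧ (u ∨ ¬ u) ≈⟨ ∧-congˡ (∨-complementʳ u) ⟩
    (a ∨ ¬ u) ∧ ⊤         ≈⟨ ∧-identityʳ _ ⟩
    a ∨ ¬ u               ∎

  ¬-∧-∧ : ∀ a u → ¬ (a ∧ u) ∧ u ≈ ¬ a ∧ u
  ¬-∧-∧ a u = begin
    ¬ (a ∧ u) ∧ u         ≈⟨ ∧-congʳ (deMorgan₁ a u) ⟩
    (¬ a ∨ ¬ u) ∧ u       ≈⟨ ∨-¬-∧ (¬ a) u ⟩
    ¬ a ∧ u               ∎

  ∧-∧-∨¬ : ∀ a b u → (a ∧ u) ∧ (b ∨ ¬ u) ≈ (a ∧ b) ∧ u
  ∧-∧-∨¬ a b u = begin
    (a ∧ u) ∧ (b ∨ ¬ u) ≈⟨ ∧-comm (a ∧ u) _ ⟩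
    (b ∨ ¬ u) ∧ (a ∧ u) ≈⟨ sym (∧-assoc _ a u) ⟩
    ((b ∨ ¬ u) ∧ a) ∧ u ≈⟨ ∧-congʳ (∧-comm _ a) ⟩
    (a ∧ (b ∨ ¬ u)) ∧ u ≈⟨ ∧-assoc a _ u ⟩
    a ∧ ((b ∨ ¬ u) ∧ u) ≈⟨ ∧-congˡ (∨-¬-∧ b u) ⟩
    a ∧ (b ∧ u)         ≈⟨ sym (∧-assoc a b u) ⟩
    (a ∧ b) ∧ u         ∎

  ≤⇒∨¬≈⊤ : ∀ {a b} → a ≤ b → b ∨ ¬ a ≈ ⊤
  ≤⇒∨¬≈⊤ {a} {b} a≤b = begin
    b ∨ ¬ a         ≈⟨ ∨-congˡ (¬-cong (sym a≤b)) ⟩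
    b ∨ ¬ (a ∧ b)   ≈⟨ ∨-congˡ (deMorgan₁ a b) ⟩
    b ∨ (¬ a ∨ ¬ b) ≈⟨ ∨-congˡ (∨-comm (¬ a) (¬ b)) ⟩
    b ∨ (¬ b ∨ ¬ a) ≈⟨ sym (∨-assoc b (¬ b) (¬ a)) ⟩
    (b ∨ ¬ b) ∨ ¬ a ≈⟨ ∨-congʳ (∨-complementʳ b) ⟩
    ⊤ ∨ ¬ a         ≈⟨ ∨-zeroˡ (¬ a) ⟩
    ⊤               ∎

  ∧-split : ∀ a {u v} → u ∨ v ≈ ⊤ → a ≈ (a ∧ u) ∨ (a ∧ v)
  ∧-split a {u} {v} u∨v≈⊤ = begin
    a                   ≈⟨ sym (∧-identityʳ a) ⟩
    a ∧ ⊤               ≈⟨ ∧-congˡ (sym u∨v≈⊤) ⟩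
    a ∧ (u ∨ v)         ≈⟨ ∧-distribˡ-∨ a u v ⟩
    (a ∧ u) ∨ (a ∧ v)   ∎

  ≈-glue : ∀ {a b u v} → u ∨ v ≈ ⊤ → (a ∧ u) ≈ (b ∧ u) → (a ∧ v) ≈ (b ∧ v) → a ≈ b
  ≈-glue {a} {b} u∨v≈⊤ eqᵤ eqᵥ = begin
    a                 ≈⟨ ∧-split a u∨v≈⊤ ⟩
    (a ∧ _) ∨ (a ∧ _) ≈⟨ ∨-cong eqᵤ eqᵥ ⟩
    (b ∧ _) ∨ (b ∧ _) ≈⟨ sym (∧-split b u∨v≈⊤) ⟩
    b                 ∎

  ∨¬-∧-∨¬ : ∀ b {u v} → u ∨ v ≈ ⊤ → (b ∨ ¬ u) ∧ (b ∨ ¬ v) ≈ b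
  ∨¬-∧-∨¬ b {u} {v} u∨v≈⊤ = begin
    (b ∨ ¬ u) ∧ (b ∨ ¬ v) ≈⟨ sym (∨-distribˡ-∧ b (¬ u) (¬ v)) ⟩
    b ∨ (¬ u ∧ ¬ v)       ≈⟨ ∨-congˡ (sym (deMorgan₂ u v)) ⟩
    b ∨ ¬ (u ∨ v)         ≈⟨ ∨-congˡ (trans (¬-cong u∨v≈⊤) ¬⊤≈⊥) ⟩
    b ∨ ⊥                 ≈⟨ ∨-identityʳ b ⟩
    b                     ∎

  ≺-resp-≈ : ∀ {a a′ b b′} → a ≈ a′ → b ≈ b′ → a ≺ b → a′ ≺ b′
  ≺-resp-≈ a≈a′ b≈b′ a≺b = ≺-mono (≤-reflexive (sym a≈a′)) a≺b (≤-reflexive b≈b′)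

  ≺-≈⊤ : ∀ {a b} → b ≈ ⊤ → a ≺ b
  ≺-≈⊤ {a} b≈⊤ = ≺-mono (∧-identityʳ a) ≺-⊤ (≤-reflexive (sym b≈⊤))

  ≈⊥-≺ : ∀ {a b} → a ≈ ⊥ → a ≺ b
  ≈⊥-≺ {b = b} a≈⊥ = ≺-mono (≤-reflexive a≈⊥) ≺-⊥ (∧-zeroˡ b)

  ≺-cut : ∀ {a b u} → a ≺ (b ∨ ¬ u) → a ≺ u → a ≺ b
  ≺-cut {b = b} {u} a≺b∨¬u a≺u =
    ≺-mono ≤-refl (≺-∧ a≺b∨¬u a≺u) (≤-trans (≤-reflexive (∨-¬-∧ b u)) (x∧y≤x b u))

  infix 4 _≺[_]_
  _≺[_]_ : Carrier → Carrier → Carrier → Set ℓ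
  a ≺[ u ] b = (a ∧ u) ≺ (b ∨ ¬ u)

  ≺⇒≺[] : ∀ u {a b} → a ≺ b → a ≺[ u ] b
  ≺⇒≺[] u {a} {b} a≺b = ≺-mono (x∧y≤x a u) a≺b (x≤x∨y b (¬ u))

  ≺[]⇒≺ : ∀ {x y a b} → x ≺ y → a ≺[ y ] b → a ≺[ ¬ x ] b → a ≺ b
  ≺[]⇒≺ {x} {y} {a} {b} x≺y a≺[y]b a≺[¬x]b =
    ≺-resp-≈ (sym a≈) refl (≺-∨ (≺-∨ inside-x between) outside-y)
    where
    y∨¬x≈⊤ : y ∨ ¬ x ≈ ⊤
    y∨¬x≈⊤ = ≤⇒∨¬≈⊤ (≺⇒≤ x≺y)
    a≈ : a ≈ (((a ∧ y) ∧ x) ∨ ((a ∧ y) ∧ ¬ x)) ∨ (a ∧ ¬ y)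
    a≈ = trans (∧-split a (∨-complementʳ y)) (∨-congʳ (∧-split (a ∧ y) (∨-complementʳ x)))
    inside-x : (a ∧ y) ∧ x ≺ b
    inside-x = ≺-cut (≺-mono (x∧y≤x (a ∧ y) x) a≺[y]b ≤-refl)
                     (≺-mono (x∧y≤y (a ∧ y) x) x≺y ≤-refl)
    between : (a ∧ y) ∧ ¬ x ≺ b
    between = ≺-resp-≈ refl (∨¬-∧-∨¬ b y∨¬x≈⊤) (≺-∧
      (≺-mono (x∧y≤x (a ∧ y) (¬ x)) a≺[y]b ≤-refl)
      (≺-mono (∧-greatest (≤-trans (x∧y≤x (a ∧ y) (¬ x)) (x∧y≤x a y)) (x∧y≤y (a ∧ y) (¬ x)))
              a≺[¬x]b ≤-refl))
    outside-y : a ∧ ¬ y ≺ b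
    outside-y = ≺-cut (≺-mono (∧-greatest (x∧y≤x a (¬ y)) (≺⇒≤ a∧¬y≺¬x)) a≺[¬x]b ≤-refl) a∧¬y≺¬x
      where
      a∧¬y≺¬x : a ∧ ¬ y ≺ ¬ x
      a∧¬y≺¬x = ≺-mono (x∧y≤y a (¬ y)) (≺-¬ x≺y) ≤-refl

module RelativeContactAlgebra {c ℓ} (A : ContactAlgebra c ℓ) (u : ContactAlgebra.Carrier A) where
  open ContactAlgebra A
  open ContactAlgebraProperties A
  open BooleanAlgebraProperties boolAlg using (∧-zeroˡ; ∨-zeroˡ; ¬-involutive; deMorgan₁; deMorgan₂)

  _≈ᵤ_ : Carrier → Carrier → Set ℓ
  a ≈ᵤ b = a ∧ u ≈ b ∧ u

  ∧-congᵤ : ∀ {a a′ b b′} → a ≈ᵤ a′ → b ≈ᵤ b′ → (a ∧ b) ≈ᵤ (a′ ∧ b′)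
  ∧-congᵤ {a} {a′} {b} {b′} eqa eqb =
    trans (∧-distribʳ-∧ a b u) (trans (∧-cong eqa eqb) (sym (∧-distribʳ-∧ a′ b′ u)))

  ∨-congᵤ : ∀ {a a′ b b′} → a ≈ᵤ a′ → b ≈ᵤ b′ → (a ∨ b) ≈ᵤ (a′ ∨ b′)
  ∨-congᵤ {a} {a′} {b} {b′} eqa eqb =
    trans (∧-distribʳ-∨ u a b) (trans (∨-cong eqa eqb) (sym (∧-distribʳ-∨ u a′ b′)))

  ¬-congᵤ : ∀ {a a′} → a ≈ᵤ a′ → (¬ a) ≈ᵤ (¬ a′)
  ¬-congᵤ {a} {a′} eq = trans (sym (¬-∧-∧ a u)) (trans (∧-congʳ (¬-cong eq)) (¬-∧-∧ a′ u))

  booleanAlgebra : BooleanAlgebra c ℓ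
  booleanAlgebra = record
    { Carrier = Carrier
    ; _≈_ = _≈ᵤ_
    ; _∨_ = _∨_
    ; _∧_ = _∧_
    ; ¬_ = ¬_
    ; ⊤ = ⊤
    ; ⊥ = ⊥
    ; isBooleanAlgebra = isBooleanAlgebra-coarsen isBooleanAlgebra
        (record { refl = refl ; sym = sym ; trans = trans })
        ∧-congʳ ∨-congᵤ ∧-congᵤ ¬-congᵤ
    }

  ≺ᵤ-mono : ∀ {a b d e} → (a ∧ b) ≈ᵤ a → b ≺[ u ] d → (d ∧ e) ≈ᵤ d → a ≺[ u ] e
  ≺ᵤ-mono {a} {b} {d} {e} a≤b b≺d d≤e = ≺-mono (trans (sym (∧-distribʳ-∧ a b u)) a≤b) b≺d d∨¬u≤e∨¬u
    where
    d∨¬u≤e∨¬u : ((d ∨ ¬ u) ∧ (e ∨ ¬ u)) ≈ (d ∨ ¬ u)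
    d∨¬u≤e∨¬u = trans (sym (∨-distribʳ-∧ (¬ u) d e))
                (trans (sym (∧-¬-∨ (d ∧ e) u)) (trans (∨-congʳ d≤e) (∧-¬-∨ d u)))

  ≺ᵤ-¬ : ∀ {a b} → a ≺[ u ] b → ¬ b ≺[ u ] ¬ a
  ≺ᵤ-¬ {a} {b} a≺b =
    ≺-resp-≈ (trans (deMorgan₂ b (¬ u)) (∧-congˡ (¬-involutive u))) (deMorgan₁ a u) (≺-¬ a≺b)

  contactAlgebra : ContactAlgebra c ℓ
  contactAlgebra = record
    { boolAlg = booleanAlgebra
    ; _≺_     = _≺[ u ]_
    ; ≺-⊥     = ≈⊥-≺ (∧-zeroˡ u)
    ; ≺-⊤     = ≺-≈⊤ (∨-zeroˡ (¬ u))
    ; ≺-∧     = λ {a} {b} {d} a≺b a≺d → ≺-resp-≈ refl (sym (∨-distribʳ-∧ (¬ u) b d)) (≺-∧ a≺b a≺d)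
    ; ≺-∨     = λ {a} {b} a≺d b≺d → ≺-resp-≈ (sym (∧-distribʳ-∨ u a b)) refl (≺-∨ a≺d b≺d)
    ; ≺-mono  = ≺ᵤ-mono
    ; ≺⇒≤     = λ {a} {b} a≺b → trans (sym (∧-∧-∨¬ a b u)) (≺⇒≤ a≺b)
    ; ≺-¬     = ≺ᵤ-¬
    }

infixl 7 _∣_
_∣_ : ∀ {c ℓ} (A : ContactAlgebra c ℓ) → ContactAlgebra.Carrier A → ContactAlgebra c ℓ
_∣_ = RelativeContactAlgebra.contactAlgebra

module _ {c ℓ} (A B : ContactAlgebra c ℓ) where
  private
    module A = ContactAlgebra A
    module B = ContactAlgebra B

  infixr 2 _×-contactAlgebra_
  _×-contactAlgebra_ : ContactAlgebra c ℓ
  _×-contactAlgebra_ = record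
    { boolAlg = A.boolAlg ×-booleanAlgebra B.boolAlg
    ; _≺_     = λ p q → proj₁ p A.≺ proj₁ q × proj₂ p B.≺ proj₂ q
    ; ≺-⊥     = A.≺-⊥ , B.≺-⊥
    ; ≺-⊤     = A.≺-⊤ , B.≺-⊤
    ; ≺-∧     = λ (p , q) (p′ , q′) → A.≺-∧ p p′ , B.≺-∧ q q′
    ; ≺-∨     = λ (p , q) (p′ , q′) → A.≺-∨ p p′ , B.≺-∨ q q′
    ; ≺-mono  = λ (p , q) (p′ , q′) (p″ , q″) → A.≺-mono p p′ p″ , B.≺-mono q q′ q″
    ; ≺⇒≤     = λ (p , q) → A.≺⇒≤ p , B.≺⇒≤ q
    ; ≺-¬     = λ (p , q) → A.≺-¬ p , B.≺-¬ q
    }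

module _ {c ℓ} (A : ContactAlgebra c ℓ) where
  open ContactAlgebra A
  open ContactAlgebraProperties A
  open BooleanAlgebraProperties boolAlg using (∧-zeroˡ)

  diagonalEmbedding : ∀ {x y} → x ≺ y → Embedding A (A ∣ y ×-contactAlgebra A ∣ ¬ x)
  diagonalEmbedding {x} {y} x≺y = record
    { f      = λ a → a , a
    ; f-cong = λ a≈b → ∧-congʳ a≈b , ∧-congʳ a≈b
    ; f-inj  = λ (eqy , eq¬x) → ≈-glue (≤⇒∨¬≈⊤ (≺⇒≤ x≺y)) eqy eq¬x
    ; f-∧    = λ _ _ → refl , refl
    ; f-∨    = λ _ _ → refl , refl
    ; f-¬    = λ _ → refl , refl
    ; f-⊤    = refl , refl
    ; f-⊥    = refl , refl
    ; f-≺    = λ a≺b → ≺⇒≺[] y a≺b , ≺⇒≺[] (¬ x) a≺b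
    ; f-≺⁻   = λ (a≺[y]b , a≺[¬x]b) → ≺[]⇒≺ x≺y a≺[y]b a≺[¬x]b
    }

  interpolant : Carrier → Carrier → QF Carrier 1
  interpolant x y = andF (var zero ≺ₜ var zero) (andF (par x ≺ₜ var zero) (var zero ≺ₜ par y))

  interpolant-diagonalEmbedding : ∀ {x y} (x≺y : x ≺ y) →
    SatEx (A ∣ y ×-contactAlgebra A ∣ ¬ x) (Embedding.f (diagonalEmbedding x≺y)) (interpolant x y)
  interpolant-diagonalEmbedding {x} {y} x≺y =
    const (y , ⊥) , (y≺[y]- , ⊥≺[¬x]-) , (y≺[y]- , ≈⊥-≺ (∧-complementʳ x)) , (y≺[y]- , ⊥≺[¬x]-)
    where
    y≺[y]- : ∀ {a} → a ≺[ y ] y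
    y≺[y]- = ≺-≈⊤ (∨-complementʳ y)
    ⊥≺[¬x]- : ∀ {b} → ⊥ ≺[ ¬ x ] b
    ⊥≺[¬x]- = ≈⊥-≺ (∧-zeroˡ (¬ x))

mainTheorem7 : ∀ {c ℓ} (A : ContactAlgebra c ℓ) → IsExistentiallyClosed A →
    let open ContactAlgebra A in
    ∀ x y → x ≺ y → Σ Carrier (λ z → (z ≺ z) × (x ≺ z) × (z ≺ y))
mainTheorem7 A isEC x y x≺y
  with isEC _ (diagonalEmbedding A x≺y) (interpolant A x y) (interpolant-diagonalEmbedding A x≺y)
... | ρ , z≺z , x≺z , z≺y = ρ zero , z≺z , x≺z , z≺y
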